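{- Let $n=p_1^{n_1}\cdots p_r^{n_r}$ with primes $p_1<\cdots<p_r$, positive integers $n_i$, and $r\geq 3$. For all $a,b\in[r]$ with $a\neq b$, $s\in[n_a]$ and $t\in[n_b]$, the set $X_{a,b}^{s,t}$ is a cut-set of $\mathcal{P}(C_n)$.
   Context: $C_n$ is the cyclic group of order $n$; $[m]=\{1,\dots,m\}$. The power graph $\mathcal{P}(C_n)$ has vertex set $C_n$, two distinct vertices adjacent if one is a power of the other. A cut-set is a vertex set whose removal leaves a disconnected induced subgraph. $E_d$ is the set of elements of $C_n$ of order $d$, $S_d$ the subgroup of order $d$. $K_{a,b}^{s,t}$ is the set of non-generators of $S_{n/(p_a^sp_b^t)}$, $H_{a,b}^{s,t}$ is the union of the sets $E_{n/(p_a^ip_b^j)}$ over $0\le i\le s$, $0\le j\le t$, $(i,j)\neq(s,t)$, and $X_{a,b}^{s,t}:=H_{a,b}^{s,t}\cup K_{a,b}^{s,t}$. -}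

module Defs where

open import Data.Nat using (ℕ; zero; suc; _+_; _*_; _^_; _≤_; _<_)
open import Data.Nat.Divisibility using (_∣_)
open import Data.Fin using (Fin; toℕ)
import Data.Fin as F
open import Data.Product using (Σ; ∃; _×_)
open import Data.Sum using (_⊎_)
open import Relation.Binary.PropositionalEquality using (_≡_)
open import Relation.Nullary using (¬_)
open import Relation.Binary.Construct.Closure.ReflexiveTransitive using (Star)

prodFin : (r : ℕ) → (Fin r → ℕ) → ℕ
prodFin zero    f = 1
prodFin (suc r) f = f F.zero * prodFin r (λ i → f (F.suc i))

-- The cyclic group C_n is modelled additively as Fin n (= ℤ/nℤ).
-- y is a power (= multiple, additively) of x:  y ≡ k·x (mod n) for some k.
IsPowerOf : (n : ℕ) → Fin n → Fin n → Set
IsPowerOf n y x = ∃ λ k → ∃ λ q → k * toℕ x ≡ q * n + toℕ y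

Adj : (n : ℕ) → Fin n → Fin n → Set
Adj n x y = ¬ (x ≡ y) × (IsPowerOf n y x ⊎ IsPowerOf n x y)

HasOrder : (n : ℕ) → Fin n → ℕ → Set
HasOrder n x d = (0 < d) × (n ∣ d * toℕ x) × (∀ d' → 0 < d' → n ∣ d' * toℕ x → d ≤ d')

InE : (n d : ℕ) → Fin n → Set
InE n d x = HasOrder n x d

-- S_m : the subgroup of order m (m ∣ n), i.e. { x : m·x = 0 }
InS : (n m : ℕ) → Fin n → Set
InS n m x = n ∣ m * toℕ x

AdjOutside : (n : ℕ) → (Fin n → Set) → Fin n → Fin n → Set
AdjOutside n X x y = ¬ X x × ¬ X y × Adj n x y

IsCutSet : (n : ℕ) → (Fin n → Set) → Set
IsCutSet n X = ∃ λ u → ∃ λ v → ¬ X u × ¬ X v × ¬ Star (AdjOutside n X) u v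

module _ (n : ℕ) {r : ℕ} (p e : Fin r → ℕ) (a b : Fin r) (s t : ℕ) where

  -- K_{a,b}^{s,t}: non-generators of S_m, m = n/(p_a^s p_b^t)
  -- (m given by  m * p_a^s * p_b^t ≡ n)
  InK : Fin n → Set
  InK x = ∃ λ m → (m * (p a ^ s * p b ^ t) ≡ n) × InS n m x × ¬ HasOrder n x m

  InH : Fin n → Set
  InH x = ∃ λ i → ∃ λ j → i ≤ s × j ≤ t × ¬ (i ≡ s × j ≡ t) ×
          ∃ λ d → (d * (p a ^ i * p b ^ j) ≡ n) × InE n d x

  InX : Fin n → Set
  InX x = InH x ⊎ InK x

-- The element L = p_a^s p_b^t of C_n has order M = n / L, and this order is preserved along
-- every edge of P(C_n) avoiding X. A power y of an element of order M lies in S_M and, not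
-- being in K, generates it. If instead x of order M is a power of y, then gcd(n, y) divides
-- gcd(n, x) = L, so y has order n / (p_a^i p_b^j) with i ≤ s, j ≤ t, and y ∉ H forces
-- (i, j) = (s, t). As r ≥ 3 there is a third prime p_c ∣ n; the element p_c lies outside X
-- but does not have order M (that would give L ∣ p_c), so no path outside X joins it to L.
module Submission where

open import Data.Nat
open import Data.Nat.Properties
open import Data.Nat.Divisibility
open import Data.Nat.DivMod using (_/_; m/n*n≡m)
open import Data.Nat.GCD
open import Data.Nat.Primality
open import Data.Nat.Coprimality using (Coprime; coprime-divisor; coprime-/gcd; 1-coprimeTo)
import Data.Nat.Coprimality as Coprime
open import Data.Fin using (Fin; toℕ; fromℕ<)
import Data.Fin as F
import Data.Fin.Properties as FinP
open import Data.Product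
open import Data.Sum
open import Data.Empty
open import Function using (id; _∘_)
open import Relation.Nullary
open import Relation.Nullary.Decidable using (decidable-stable)
open import Relation.Binary.PropositionalEquality
open import Relation.Binary.Definitions using (tri<; tri≈; tri>)
open import Relation.Binary.Construct.Closure.ReflexiveTransitive using (fold)
open import Algebra.Properties.CommutativeSemigroup *-commutativeSemigroup using (x∙yz≈y∙xz)
open import Defs

private
  variable
    p q d : ℕ

prime≢1 : Prime p → p ≢ 1
prime≢1 pp = nonTrivial⇒≢1 {{prime⇒nonTrivial pp}}

prime⇒>1 : Prime p → 1 < p
prime⇒>1 {p} pp = nonTrivial⇒n>1 p {{prime⇒nonTrivial pp}}

prime∤1 : Prime p → ¬ p ∣ 1
prime∤1 pp = prime≢1 pp ∘ ∣1⇒≡1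

prime∤prime : Prime p → Prime q → p ≢ q → ¬ p ∣ q
prime∤prime pp pq p≢q p∣q with prime⇒irreducible pq p∣q
... | inj₁ p≡1 = prime≢1 pp p≡1
... | inj₂ p≡q = p≢q p≡q

prime∤^ : Prime p → Prime q → p ≢ q → ∀ j → ¬ p ∣ q ^ j
prime∤^ pp pq p≢q zero = prime∤1 pp
prime∤^ {q = q} pp pq p≢q (suc j) p∣q^1+j with euclidsLemma q (q ^ j) pp p∣q^1+j
... | inj₁ p∣q   = prime∤prime pp pq p≢q p∣q
... | inj₂ p∣q^j = prime∤^ pp pq p≢q j p∣q^j

prime∤⇒coprime : Prime p → ¬ p ∣ d → Coprime d p
prime∤⇒coprime pp p∤d (c∣d , c∣p) with prime⇒irreducible pp c∣p
... | inj₁ c≡1 = c≡1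
... | inj₂ refl = ⊥-elim (p∤d c∣d)

^-monoʳ-∣ : ∀ p {i j} → i ≤ j → p ^ i ∣ p ^ j
^-monoʳ-∣ p {j = j} z≤n = 1∣ (p ^ j)
^-monoʳ-∣ p (s≤s i≤j)  = *-monoʳ-∣ p (^-monoʳ-∣ p i≤j)

-- Peel off the powers of p dividing d one at a time; a factor not divisible by p is coprime to it.
p∣p^k : ∀ p {k} → 1 ≤ k → p ∣ p ^ k
p∣p^k p {suc k} _ = m∣m*n (p ^ k)

∣^*⇒≡^*∣ : Prime p → ∀ s {m d} → d ∣ p ^ s * m →
           ∃₂ λ i d′ → i ≤ s × d ≡ p ^ i * d′ × d′ ∣ m
∣^*⇒≡^*∣ pp zero {m} {d} d∣m =
  0 , d , z≤n , sym (*-identityˡ d) , subst (d ∣_) (*-identityˡ m) d∣m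
∣^*⇒≡^*∣ {p} pp (suc s) {m} {d} d∣p^1+s*m with p ∣? d
... | yes (divides d′ refl) =
  let instance _ = prime⇒nonZero pp
      rearrange : p * p ^ s * m ≡ p ^ s * m * p
      rearrange = trans (*-assoc p (p ^ s) m) (*-comm p (p ^ s * m))
      (i , d″ , i≤s , d′≡ , d″∣m) =
        ∣^*⇒≡^*∣ pp s (*-cancelʳ-∣ {d′} p (subst (d′ * p ∣_) rearrange d∣p^1+s*m))
  in suc i , d″ , s≤s i≤s ,
     trans (cong (_* p) d′≡) (trans (*-comm (p ^ i * d″) p) (sym (*-assoc p (p ^ i) d″))) , d″∣m
... | no p∤d =
  let (i , d′ , i≤s , d≡ , d′∣m) =
        ∣^*⇒≡^*∣ pp s (coprime-divisor (prime∤⇒coprime pp p∤d)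
                                         (subst (d ∣_) (*-assoc p (p ^ s) m) d∣p^1+s*m))
  in i , d′ , m≤n⇒m≤1+n i≤s , d≡ , d′∣m

∣^*^⇒≡^*^ : Prime p → Prime q → ∀ s t {d} → d ∣ p ^ s * q ^ t →
            ∃₂ λ i j → i ≤ s × j ≤ t × d ≡ p ^ i * q ^ j
∣^*^⇒≡^*^ {p} {q} pp pq s t d∣ =
  let (i , d₁ , i≤s , d≡ , d₁∣) = ∣^*⇒≡^*∣ pp s d∣
      (j , d₂ , j≤t , d₁≡ , d₂∣1) =
        ∣^*⇒≡^*∣ pq t (subst (d₁ ∣_) (sym (*-identityʳ (q ^ t))) d₁∣)
      d₁≡q^j = trans d₁≡ (trans (cong (q ^ j *_) (∣1⇒≡1 d₂∣1)) (*-identityʳ (q ^ j)))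
  in i , j , i≤s , j≤t , trans d≡ (cong (p ^ i *_) d₁≡q^j)

p^i*q^j<p^s*q^t : ∀ {i j s t} → 1 < p → 1 < q → i ≤ s → j ≤ t → ¬ (i ≡ s × j ≡ t) →
                  p ^ i * q ^ j < p ^ s * q ^ t
p^i*q^j<p^s*q^t {p} {q} {i} {j} {s} {t} 1<p 1<q i≤s j≤t ij≢st with i ≟ s
... | no i≢s = <-≤-trans (*-monoˡ-< (q ^ j) (^-monoʳ-< p 1<p (≤∧≢⇒< i≤s i≢s)))
                         (*-monoʳ-≤ (p ^ s) (^-monoʳ-≤ q j≤t))
  where instance
    q≢0 : NonZero q
    q≢0 = >-nonZero (<-trans z<s 1<q)
    q^j≢0 : NonZero (q ^ j)
    q^j≢0 = m^n≢0 q j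
... | yes refl = *-monoʳ-< (p ^ i) (^-monoʳ-< q 1<q (≤∧≢⇒< j≤t (ij≢st ∘ (refl ,_))))
  where instance
    p^i≢0 : NonZero (p ^ i)
    p^i≢0 = m^n≢0 p i {{>-nonZero (<-trans z<s 1<p)}}

prodFin≢0 : ∀ r (f : Fin r → ℕ) → (∀ i → NonZero (f i)) → NonZero (prodFin r f)
prodFin≢0 zero    f f≢0 = _
prodFin≢0 (suc r) f f≢0 =
  m*n≢0 (f F.zero) _ {{f≢0 F.zero}} {{prodFin≢0 r (f ∘ F.suc) (f≢0 ∘ F.suc)}}

∣prodFin : ∀ r (f : Fin r → ℕ) i → f i ∣ prodFin r f
∣prodFin (suc r) f F.zero    = m∣m*n _
∣prodFin (suc r) f (F.suc i) = ∣n⇒∣m*n (f F.zero) (∣prodFin r (f ∘ F.suc) i)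

*∣prodFin : ∀ r (f : Fin r → ℕ) i j → i ≢ j → f i * f j ∣ prodFin r f
*∣prodFin (suc r) f F.zero    F.zero    i≢j = ⊥-elim (i≢j refl)
*∣prodFin (suc r) f F.zero    (F.suc j) i≢j = *-monoʳ-∣ (f F.zero) (∣prodFin r (f ∘ F.suc) j)
*∣prodFin (suc r) f (F.suc i) F.zero    i≢j =
  subst (_∣ prodFin (suc r) f) (*-comm (f F.zero) (f (F.suc i)))
        (*-monoʳ-∣ (f F.zero) (∣prodFin r (f ∘ F.suc) i))
*∣prodFin (suc r) f (F.suc i) (F.suc j) i≢j =
  ∣n⇒∣m*n (f F.zero) (*∣prodFin r (f ∘ F.suc) i j (i≢j ∘ cong F.suc))

∃≢-both : ∀ {r} → 3 ≤ r → (a b : Fin r) → ∃ λ c → c ≢ a × c ≢ b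
∃≢-both (s≤s (s≤s (s≤s _))) = pick
  where
  pick : ∀ {r} (a b : Fin (3 + r)) → ∃ λ c → c ≢ a × c ≢ b
  pick F.zero             F.zero             = F.suc F.zero , (λ ()) , (λ ())
  pick F.zero             (F.suc F.zero)     = F.suc (F.suc F.zero) , (λ ()) , (λ ())
  pick F.zero             (F.suc (F.suc _))  = F.suc F.zero , (λ ()) , (λ ())
  pick (F.suc F.zero)     F.zero             = F.suc (F.suc F.zero) , (λ ()) , (λ ())
  pick (F.suc F.zero)     (F.suc _)          = F.zero , (λ ()) , (λ ())
  pick (F.suc (F.suc _))  F.zero             = F.suc F.zero , (λ ()) , (λ ())
  pick (F.suc (F.suc _))  (F.suc _)          = F.zero , (λ ()) , (λ ())

strictMono⇒≢ : ∀ {r} (f : Fin r → ℕ) → (∀ i j → i F.< j → f i < f j) →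
               ∀ {i j} → i ≢ j → f i ≢ f j
strictMono⇒≢ f mono {i} {j} i≢j with FinP.<-cmp i j
... | tri< i<j _ _ = <⇒≢ (mono i j i<j)
... | tri≈ _ i≡j _ = ⊥-elim (i≢j i≡j)
... | tri> _ _ j<i = ≢-sym (<⇒≢ (mono j i j<i))

Fin⇒nonZero : ∀ {n} → Fin n → NonZero n
Fin⇒nonZero {suc _} _ = _

hasOrder-unique : ∀ {n x d d′} → HasOrder n x d → HasOrder n x d′ → d ≡ d′
hasOrder-unique (d>0 , n∣dx , d-min) (d′>0 , n∣d′x , d′-min) =
  ≤-antisym (d-min _ d′>0 n∣d′x) (d′-min _ d>0 n∣dx)

coprime⇒hasOrder : ∀ {n g k} (x : Fin n) .{{_ : NonZero g}} →
                   d * g ≡ n → k * g ≡ toℕ x → Coprime d k → HasOrder n x d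
coprime⇒hasOrder {d} {n} {g} {k} x d*g≡n k*g≡x d⊥k = d>0 , n∣dx , d-min
  where
  open ≡-Reasoning
  d>0 : 0 < d
  d>0 = >-nonZero⁻¹ d {{m*n≢0⇒m≢0 d {{subst NonZero (sym d*g≡n) (Fin⇒nonZero x)}}}}
  n∣dx : n ∣ d * toℕ x
  n∣dx = divides k (begin
    d * toℕ x    ≡⟨ cong (d *_) (sym k*g≡x) ⟩
    d * (k * g)  ≡⟨ x∙yz≈y∙xz d k g ⟩
    k * (d * g)  ≡⟨ cong (k *_) d*g≡n ⟩
    k * n        ∎)
  d-min : ∀ d′ → 0 < d′ → n ∣ d′ * toℕ x → d ≤ d′
  d-min d′ d′>0 (divides c d′x≡cn) =
    ∣⇒≤ {{>-nonZero d′>0}} (coprime-divisor d⊥k (*-cancelʳ-∣ g dg∣kd′g))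
    where
    dg∣kd′g : d * g ∣ k * d′ * g
    dg∣kd′g = divides c (begin
      k * d′ * g    ≡⟨ cong (_* g) (*-comm k d′) ⟩
      d′ * k * g    ≡⟨ *-assoc d′ k g ⟩
      d′ * (k * g)  ≡⟨ cong (d′ *_) k*g≡x ⟩
      d′ * toℕ x    ≡⟨ d′x≡cn ⟩
      c * n         ≡⟨ cong (c *_) d*g≡n ⟨
      c * (d * g)   ∎)

hasOrder-gcd : ∀ {n} (x : Fin n) → ∃ λ d → HasOrder n x d × d * gcd n (toℕ x) ≡ n
hasOrder-gcd {n} x =
  n / g ,
  coprime⇒hasOrder x d*g≡n (m/n*n≡m (gcd[m,n]∣n n (toℕ x))) (coprime-/gcd n (toℕ x)) ,
  d*g≡n
  where
  g = gcd n (toℕ x)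
  instance
    g≢0 : NonZero g
    g≢0 = ≢-nonZero (gcd[m,n]≢0 n (toℕ x) (inj₁ (≢-nonZero⁻¹ n {{Fin⇒nonZero x}})))
  d*g≡n : n / g * g ≡ n
  d*g≡n = m/n*n≡m (gcd[m,n]∣m n (toℕ x))

hasOrder? : ∀ n (x : Fin n) d → Dec (HasOrder n x d)
hasOrder? n x d with hasOrder-gcd x
... | d₀ , ord₀ , _ with d₀ ≟ d
...   | yes refl = yes ord₀
...   | no d₀≢d  = no (d₀≢d ∘ hasOrder-unique ord₀)

hasOrder⇒gcd≡ : ∀ {n x m} → HasOrder n x d → d * m ≡ n → gcd n (toℕ x) ≡ m
hasOrder⇒gcd≡ {d} {x = x} {m} ord d*m≡n with hasOrder-gcd x
... | d₀ , ord₀ , d₀*g≡n rewrite hasOrder-unique ord₀ ord =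
  *-cancelˡ-≡ _ m d {{>-nonZero (proj₁ ord)}} (trans d₀*g≡n (sym d*m≡n))

hasOrder-fromℕ< : ∀ {n m} → d * m ≡ n → (m<n : m < n) → HasOrder n (fromℕ< m<n) d
hasOrder-fromℕ< {d} {n} {m} d*m≡n m<n =
  coprime⇒hasOrder (fromℕ< m<n) {{m≢0}} d*m≡n (trans (*-identityˡ m) (sym (FinP.toℕ-fromℕ< m<n)))
                   (Coprime.sym (1-coprimeTo d))
  where
  m≢0 : NonZero m
  m≢0 = m*n≢0⇒n≢0 d {{subst NonZero (sym d*m≡n) (>-nonZero (<-≤-trans z<s m<n))}}

isPowerOf-pres-InS : ∀ {n x y} → IsPowerOf n y x → InS n d x → InS n d y
isPowerOf-pres-InS {d} {n} {x} {y} (k , q , kx≡qn+y) n∣dx =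
  ∣m+n∣m⇒∣n n∣dqn+dy (divides (d * q) (sym (*-assoc d q n)))
  where
  open ≡-Reasoning
  n∣dqn+dy : n ∣ d * (q * n) + d * toℕ y
  n∣dqn+dy = subst (n ∣_) (begin
    k * (d * toℕ x)             ≡⟨ x∙yz≈y∙xz k d (toℕ x) ⟩
    d * (k * toℕ x)             ≡⟨ cong (d *_) kx≡qn+y ⟩
    d * (q * n + toℕ y)         ≡⟨ *-distribˡ-+ d (q * n) (toℕ y) ⟩
    d * (q * n) + d * toℕ y     ∎) (∣n⇒∣m*n k n∣dx)

isPowerOf⇒gcd∣gcd : ∀ {n x y} → IsPowerOf n y x → gcd n (toℕ x) ∣ gcd n (toℕ y)
isPowerOf⇒gcd∣gcd {n} {x} {y} (k , q , kx≡qn+y) = gcd-greatest (gcd[m,n]∣m n (toℕ x)) g∣y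
  where
  g∣y : gcd n (toℕ x) ∣ toℕ y
  g∣y = ∣m+n∣m⇒∣n (subst (gcd n (toℕ x) ∣_) kx≡qn+y (∣n⇒∣m*n k (gcd[m,n]∣n n (toℕ x))))
                  (∣n⇒∣m*n q (gcd[m,n]∣m n (toℕ x)))

isCutSet-by-invariant : ∀ {n} {X : Fin n → Set} (I : Fin n → Set) →
                        (∀ {x y} → AdjOutside n X x y → I x → I y) →
                        ∀ {u v} → ¬ X u → ¬ X v → I u → ¬ I v → IsCutSet n X
isCutSet-by-invariant I pres {u} {v} u∉X v∉X Iu ¬Iv =
  u , v , u∉X , v∉X ,
  λ path → ¬Iv (fold (λ x y → I x → I y) (λ edge rest → rest ∘ pres edge) id path Iu)

module CutSet {r} (p e : Fin r → ℕ) (a b c : Fin r)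
  (P-prime : Prime (p a)) (Q-prime : Prime (p b)) (R-prime : Prime (p c))
  (R≢P : p c ≢ p a) (R≢Q : p c ≢ p b)
  (n : ℕ) {{n≢0 : NonZero n}} (s t : ℕ) (1≤s : 1 ≤ s)
  (L∣n : p a ^ s * p b ^ t ∣ n) (R∣n : p c ∣ n) where

  P Q R L M N : ℕ
  P = p a
  Q = p b
  R = p c
  L = P ^ s * Q ^ t
  M = quotient L∣n
  N = quotient R∣n

  X : Fin n → Set
  X = InX n p e a b s t

  M*L≡n : M * L ≡ n
  M*L≡n = sym (m∣n⇒n≡quotient*m L∣n)

  N*R≡n : N * R ≡ n
  N*R≡n = sym (m∣n⇒n≡quotient*m R∣n)

  instance
    L≢0 : NonZero L
    L≢0 = m*n≢0⇒n≢0 M {{subst NonZero (sym M*L≡n) n≢0}}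

  P∣L : P ∣ L
  P∣L = ∣m⇒∣m*n (Q ^ t) (p∣p^k P 1≤s)

  P∤R : ¬ P ∣ R
  P∤R = prime∤prime P-prime R-prime (R≢P ∘ sym)

  R∤P^i*Q^j : ∀ i j → ¬ R ∣ P ^ i * Q ^ j
  R∤P^i*Q^j i j R∣ with euclidsLemma (P ^ i) (Q ^ j) R-prime R∣
  ... | inj₁ R∣P^i = prime∤^ R-prime P-prime R≢P i R∣P^i
  ... | inj₂ R∣Q^j = prime∤^ R-prime Q-prime R≢Q j R∣Q^j

  L<n : L < n
  L<n = ≤∧≢⇒< (∣⇒≤ L∣n) (λ L≡n → R∤P^i*Q^j s t (subst (R ∣_) (sym L≡n) R∣n))

  R<n : R < n
  R<n = ≤∧≢⇒< (∣⇒≤ R∣n) (λ R≡n → P∤R (subst (P ∣_) (sym R≡n) (∣-trans P∣L L∣n)))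

  u v : Fin n
  u = fromℕ< L<n
  v = fromℕ< R<n

  u-order : HasOrder n u M
  u-order = hasOrder-fromℕ< M*L≡n L<n

  v-order : HasOrder n v N
  v-order = hasOrder-fromℕ< N*R≡n R<n

  P^i*Q^j≢L : ∀ {i j} → i ≤ s → j ≤ t → ¬ (i ≡ s × j ≡ t) → P ^ i * Q ^ j ≢ L
  P^i*Q^j≢L i≤s j≤t ij≢st = <⇒≢ (p^i*q^j<p^s*q^t (prime⇒>1 P-prime) (prime⇒>1 Q-prime) i≤s j≤t ij≢st)

  u∉X : ¬ X u
  u∉X (inj₁ (i , j , i≤s , j≤t , ij≢st , d , d*P^iQ^j≡n , ord)) =
    P^i*Q^j≢L i≤s j≤t ij≢st (trans (sym (hasOrder⇒gcd≡ ord d*P^iQ^j≡n)) (hasOrder⇒gcd≡ u-order M*L≡n))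
  u∉X (inj₂ (m , m*L≡n , _ , ¬ord)) =
    ¬ord (subst (HasOrder n u) (*-cancelʳ-≡ M m L (trans M*L≡n (sym m*L≡n))) u-order)

  v∉S : ∀ m → m * L ≡ n → ¬ InS n m v
  v∉S m m*L≡n n∣m*v = P∤R (∣-trans P∣L L∣R)
    where
    L∣R : L ∣ R
    L∣R = *-cancelˡ-∣ m {{m*n≢0⇒m≢0 m {{subst NonZero (sym m*L≡n) n≢0}}}}
            (subst₂ _∣_ (sym m*L≡n) (cong (m *_) (FinP.toℕ-fromℕ< R<n)) n∣m*v)

  v∉X : ¬ X v
  v∉X (inj₁ (i , j , _ , _ , _ , d , d*P^iQ^j≡n , ord)) =
    R∤P^i*Q^j i j (∣-reflexive (trans (sym (hasOrder⇒gcd≡ v-order N*R≡n)) (hasOrder⇒gcd≡ ord d*P^iQ^j≡n)))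
  v∉X (inj₂ (m , m*L≡n , v∈S , _)) = v∉S m m*L≡n v∈S

  ∉X⇒hasOrder-M : ∀ {y d i j} → ¬ X y → HasOrder n y d → i ≤ s → j ≤ t →
                  d * (P ^ i * Q ^ j) ≡ n → HasOrder n y M
  ∉X⇒hasOrder-M {y} {d} {i} {j} y∉X y-ord i≤s j≤t d*P^iQ^j≡n with i ≟ s | j ≟ t
  ... | yes refl | yes refl =
    subst (HasOrder n y) (*-cancelʳ-≡ d M L (trans d*P^iQ^j≡n (sym M*L≡n))) y-ord
  ... | no i≢s   | _        =
    ⊥-elim (y∉X (inj₁ (i , j , i≤s , j≤t , i≢s ∘ proj₁ , d , d*P^iQ^j≡n , y-ord)))
  ... | _        | no j≢t   =
    ⊥-elim (y∉X (inj₁ (i , j , i≤s , j≤t , j≢t ∘ proj₂ , d , d*P^iQ^j≡n , y-ord)))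

  hasOrder-M-step : ∀ {x y} → AdjOutside n X x y → HasOrder n x M → HasOrder n y M
  hasOrder-M-step {x} {y} (_ , y∉X , _ , inj₁ y-power) x-ord =
    decidable-stable (hasOrder? n y M) λ ¬ord →
      y∉X (inj₂ (M , M*L≡n , isPowerOf-pres-InS {d = M} y-power (proj₁ (proj₂ x-ord)) , ¬ord))
  hasOrder-M-step {x} {y} (_ , y∉X , _ , inj₂ x-power) x-ord =
    let gcd∣L : gcd n (toℕ y) ∣ L
        gcd∣L = subst (gcd n (toℕ y) ∣_) (hasOrder⇒gcd≡ x-ord M*L≡n) (isPowerOf⇒gcd∣gcd x-power)
        (i , j , i≤s , j≤t , gcd≡) = ∣^*^⇒≡^*^ P-prime Q-prime s t gcd∣L
        (d , y-ord , d*gcd≡n) = hasOrder-gcd y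
    in ∉X⇒hasOrder-M y∉X y-ord i≤s j≤t (subst (λ g → d * g ≡ n) gcd≡ d*gcd≡n)

  isCutSet : IsCutSet n X
  isCutSet = isCutSet-by-invariant (λ x → HasOrder n x M) hasOrder-M-step u∉X v∉X u-order
               (v∉S M M*L≡n ∘ proj₁ ∘ proj₂)

proposition3p5 : (r : ℕ) → 3 ≤ r → (p e : Fin r → ℕ) →
    (∀ i → Prime (p i)) → (∀ i j → i F.< j → p i < p j) → (∀ i → 1 ≤ e i) →
    (n : ℕ) → n ≡ prodFin r (λ i → p i ^ e i) →
    (a b : Fin r) → ¬ (a ≡ b) → (s t : ℕ) →
    1 ≤ s → s ≤ e a → 1 ≤ t → t ≤ e b →
    IsCutSet n (InX n p e a b s t)
proposition3p5 r 3≤r p e p-prime mono e≥1 n n≡ a b a≢b s t 1≤s s≤e _ t≤e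
  with ∃≢-both 3≤r a b
... | c , c≢a , c≢b =
  CutSet.isCutSet p e a b c (p-prime a) (p-prime b) (p-prime c)
    (strictMono⇒≢ p mono c≢a) (strictMono⇒≢ p mono c≢b) n {{n≢0}} s t 1≤s L∣n R∣n
  where
  p^e : Fin r → ℕ
  p^e i = p i ^ e i
  n≢0 : NonZero n
  n≢0 = subst NonZero (sym n≡) (prodFin≢0 r p^e (λ i → m^n≢0 (p i) (e i) {{prime⇒nonZero (p-prime i)}}))
  L∣n : p a ^ s * p b ^ t ∣ n
  L∣n = subst (p a ^ s * p b ^ t ∣_) (sym n≡)
          (∣-trans (*-pres-∣ (^-monoʳ-∣ (p a) s≤e) (^-monoʳ-∣ (p b) t≤e)) (*∣prodFin r p^e a b a≢b))
  R∣n : p c ∣ n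
  R∣n = subst (p c ∣_) (sym n≡) (∣-trans (p∣p^k (p c) (e≥1 c)) (∣prodFin r p^e c))
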